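{- Let $n\geq3$ be odd. The word $\mathbf{w}_n$ is an isoterm for ${\bf B}_2^1$.
   Context: ${\bf B}_2^1$ is the Brandt monoid $\langle \mathsf{a},\mathsf{b}\mid \mathsf{a}\mathsf{b}\mathsf{a}=\mathsf{a},\ \mathsf{b}\mathsf{a}\mathsf{b}=\mathsf{b},\ \mathsf{a}\mathsf{a}=\mathsf{b}\mathsf{b}=0\rangle$. For distinct letters $x_1,\dots,x_n,y,z$, $\mathbf{w}_n=x_1s_1x_2s_2\cdots x_ns_nx_1s_{n+1}x_2s_{n+2}\cdots s_{2n-1}x_n$ where $s_i=y$ for $i$ odd and $s_i=z$ for $i$ even; i.e. $\mathbf{w}_n=x_1yx_2z\cdots x_nyx_1zx_2y\cdots yx_n$. A word $\mathbf{w}$ is an isoterm for a monoid (or monoid variety) if whenever $\mathbf{w}\approx\mathbf{w}'$ is satisfied (with $\mathbf{w}'$ any word over the countable alphabet), $\mathbf{w}'=\mathbf{w}$. -}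

module Defs where

open import Data.Nat using (ℕ; zero; suc; _+_)
open import Data.Fin using (Fin)
open import Data.List using (List; []; _∷_; _++_; map; foldr)
open import Data.List using (allFin)
open import Relation.Binary.PropositionalEquality using (_≡_)

-- The Brandt monoid B₂¹ = ⟨a,b | aba=a, bab=b, aa=bb=0⟩ (with 1 adjoined).
-- Its six elements are 1, 0 and the 2×2 matrix units e i j
-- (a = e₁₂, b = e₂₁, ab = e₁₁, ba = e₂₂), with e i j · e k l = e i l
-- if j = k and 0 otherwise.

data Idx : Set where
  i₁ i₂ : Idx

data B21 : Set where
  𝟙 : B21
  𝟘 : B21
  e : Idx → Idx → B21

a b : B21
a = e i₁ i₂
b = e i₂ i₁

_·_ : B21 → B21 → B21
𝟙 · y = y
𝟘 · y = 𝟘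
e i j · 𝟙 = e i j
e i j · 𝟘 = 𝟘
e i i₁ · e i₁ l = e i l
e i i₂ · e i₂ l = e i l
e i i₁ · e i₂ l = 𝟘
e i i₂ · e i₁ l = 𝟘

Word : Set
Word = List ℕ

eval : (ℕ → B21) → Word → B21
eval φ = foldr (λ x m → φ x · m) 𝟙


B21⊨_≈_ : Word → Word → Set
B21⊨ u ≈ v = (φ : ℕ → B21) → eval φ u ≡ eval φ v

IsotermB21 : Word → Set
IsotermB21 w = (w' : Word) → B21⊨ w ≈ w' → w' ≡ w

sel : ℕ → ℕ → ℕ → ℕ
sel y z zero = z
sel y z (suc zero) = y
sel y z (suc (suc k)) = sel y z k

weave : List ℕ → (ℕ → ℕ) → ℕ → Word
weave [] s k = []
weave (u ∷ []) s k = u ∷ []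
weave (u ∷ u' ∷ us) s k = u ∷ s k ∷ weave (u' ∷ us) s (suc k)

-- w_n = x₁ s₁ x₂ s₂ ⋯ x_n s_n x₁ s_{n+1} x₂ ⋯ s_{2n-1} x_n
wn : (n : ℕ) → (Fin n → ℕ) → ℕ → ℕ → Word
wn n x y z = weave xs s 1 ++ (s n ∷ weave xs s (suc n))
  where
    xs = map x (allFin n)
    s = sel y z

{-# OPTIONS --safe #-}
-- Every element of B₂¹ acts on {i₁, i₂} by a partial map, so evaluating an identity
-- w_n ≈ w′ at a substitution says that a finite automaton accepts w′ exactly when it
-- accepts w_n.  After collapsing letters to x_k, y, z and "other", three families of
-- substitutions force w′ to alternate x's with separators (x ↦ a, y, z ↦ b), its
-- separators to alternate y, z (y ↦ a, z ↦ b), and the x after x_k to be x_{k+1},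
-- cyclically (x_k ↦ a, x_{k+1} ↦ b, other x ↦ ab).  So w′ is w_n or begins with
-- w_n z x₁.  The latter is excluded by x_k ↦ a for odd k, x_k ↦ 1 for even k,
-- y ↦ b, z ↦ 1: for odd n this sends w_n to a, but w_n z x₁ to a·a = 0.
module Submission where

open import Defs
open import Data.Nat using (ℕ; zero; suc; _+_; _≤_; _%_; s≤s)
open import Data.Nat.Properties using (_≟_; _<?_; +-suc; +-identityʳ; suc-injective; m+1+n≢m)
open import Data.Fin as Fin using (Fin; toℕ; fromℕ<)
open import Data.Fin.Properties using (any?; toℕ<n; fromℕ<-toℕ)
open import Data.List using (List; []; _∷_; _++_; map; foldr; tabulate; allFin)
open import Data.List.Properties using (map-++; map-tabulate; map-injective; ++-identityʳ)
open import Data.Maybe using (Maybe; just; nothing; _>>=_)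
open import Data.Maybe.Properties using (just-injective)
open import Data.Product using (∃-syntax; _×_; _,_)
open import Data.Sum using (_⊎_; inj₁; inj₂)
open import Data.Empty using (⊥-elim)
open import Function.Base using (_∘_)
open import Function.Bundles using (_⇔_; mk⇔; Equivalence)
open import Function.Definitions using (Injective)
open import Relation.Nullary using (¬_; yes; no)
open import Relation.Binary.PropositionalEquality
  using (_≡_; _≢_; refl; sym; trans; cong; cong₂; subst; module ≡-Reasoning)

act : Idx → B21 → Maybe Idx
act q 𝟙 = just q
act q 𝟘 = nothing
act i₁ (e i₁ j) = just j
act i₁ (e i₂ j) = nothing
act i₂ (e i₁ j) = nothing
act i₂ (e i₂ j) = just j

act-· : ∀ q g h → act q (g · h) ≡ (act q g >>= λ r → act r h)
act-· q 𝟙 h = refl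
act-· q 𝟘 h = refl
act-· i₁ (e i₁ i₁) 𝟙 = refl
act-· i₁ (e i₁ i₁) 𝟘 = refl
act-· i₁ (e i₁ i₁) (e i₁ l) = refl
act-· i₁ (e i₁ i₁) (e i₂ l) = refl
act-· i₁ (e i₁ i₂) 𝟙 = refl
act-· i₁ (e i₁ i₂) 𝟘 = refl
act-· i₁ (e i₁ i₂) (e i₁ l) = refl
act-· i₁ (e i₁ i₂) (e i₂ l) = refl
act-· i₁ (e i₂ i₁) 𝟙 = refl
act-· i₁ (e i₂ i₁) 𝟘 = refl
act-· i₁ (e i₂ i₁) (e i₁ l) = refl
act-· i₁ (e i₂ i₁) (e i₂ l) = refl
act-· i₁ (e i₂ i₂) 𝟙 = refl
act-· i₁ (e i₂ i₂) 𝟘 = refl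
act-· i₁ (e i₂ i₂) (e i₁ l) = refl
act-· i₁ (e i₂ i₂) (e i₂ l) = refl
act-· i₂ (e i₁ i₁) 𝟙 = refl
act-· i₂ (e i₁ i₁) 𝟘 = refl
act-· i₂ (e i₁ i₁) (e i₁ l) = refl
act-· i₂ (e i₁ i₁) (e i₂ l) = refl
act-· i₂ (e i₁ i₂) 𝟙 = refl
act-· i₂ (e i₁ i₂) 𝟘 = refl
act-· i₂ (e i₁ i₂) (e i₁ l) = refl
act-· i₂ (e i₁ i₂) (e i₂ l) = refl
act-· i₂ (e i₂ i₁) 𝟙 = refl
act-· i₂ (e i₂ i₁) 𝟘 = refl
act-· i₂ (e i₂ i₁) (e i₁ l) = refl
act-· i₂ (e i₂ i₁) (e i₂ l) = refl
act-· i₂ (e i₂ i₂) 𝟙 = refl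
act-· i₂ (e i₂ i₂) 𝟘 = refl
act-· i₂ (e i₂ i₂) (e i₁ l) = refl
act-· i₂ (e i₂ i₂) (e i₂ l) = refl

value : {A : Set} → (A → B21) → List A → B21
value f = foldr (λ c g → f c · g) 𝟙

value-map : {A B : Set} (f : B → B21) (g : A → B) (w : List A) →
            value f (map g w) ≡ value (f ∘ g) w
value-map f g [] = refl
value-map f g (c ∷ w) = cong (f (g c) ·_) (value-map f g w)

module _ {A : Set} (f : A → B21) where

  act-value-∷ : ∀ {q r} c v → act q (f c) ≡ just r →
                act q (value f (c ∷ v)) ≡ act r (value f v)
  act-value-∷ {q} c v eq =
    trans (act-· q (f c) (value f v)) (cong (_>>= λ r → act r (value f v)) eq)

  act-value-∷⁻¹ : ∀ {q s} c v → act q (value f (c ∷ v)) ≡ just s →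
                  ∃[ r ] act q (f c) ≡ just r × act r (value f v) ≡ just s
  act-value-∷⁻¹ {q} c v eq with act q (f c) | act-· q (f c) (value f v)
  ... | just r | eq′ = r , refl , trans (sym eq′) eq
  ... | nothing | eq′ with trans (sym eq′) eq
  ... | ()

  act-value-stuck : ∀ {q s} c v → act q (f c) ≡ nothing →
                    act q (value f (c ∷ v)) ≢ just s
  act-value-stuck c v stuck eq with act-value-∷⁻¹ c v eq
  ... | r , fc , _ with trans (sym stuck) fc
  ... | ()

swap : Idx → Idx
swap i₁ = i₂
swap i₂ = i₁

swap-involutive : ∀ t → swap (swap t) ≡ t
swap-involutive i₁ = refl
swap-involutive i₂ = refl

swapⁿ : ℕ → Idx → Idx
swapⁿ zero t = t
swapⁿ (suc k) t = swapⁿ k (swap t)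

swap-swapⁿ : ∀ k t → swap (swapⁿ k t) ≡ swapⁿ k (swap t)
swap-swapⁿ zero t = refl
swap-swapⁿ (suc k) t = swap-swapⁿ k (swap t)

swapⁿ-double : ∀ k t → swapⁿ (k + k) t ≡ t
swapⁿ-double zero t = refl
swapⁿ-double (suc k) t = begin
  swapⁿ (suc (k + suc k)) t    ≡⟨ cong (λ l → swapⁿ (suc l) t) (+-suc k k) ⟩
  swapⁿ (k + k) (swap (swap t)) ≡⟨ swapⁿ-double k _ ⟩
  swap (swap t)                ≡⟨ swap-involutive t ⟩
  t                            ∎
  where open ≡-Reasoning

-- i₂ for even k, i₁ for odd k, matching sel y z k = z, y.
parity : ℕ → Idx
parity k = swapⁿ k i₂

parity-suc : ∀ k → parity (suc k) ≡ swap (parity k)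
parity-suc k = sym (swap-swapⁿ k i₂)

-- The letters x_{k+1}, y, z and any other letter c, with x_{k+1} coded as X k.
data Letter : Set where
  X : ℕ → Letter
  Y Z : Letter
  O : ℕ → Letter

sep : Idx → Letter
sep i₁ = Y
sep i₂ = Z

block : ℕ → ℕ → Idx → List Letter
block i zero t = X i ∷ []
block i (suc r) t = X i ∷ sep t ∷ block (suc i) r (swap t)

alternating : Letter → B21
alternating (X _) = a
alternating Y = b
alternating Z = b
alternating (O _) = 𝟘

separating : Letter → B21
separating (X _) = 𝟙
separating Y = a
separating Z = b
separating (O _) = 𝟙

aIfEven : Idx → B21
aIfEven i₁ = 𝟙
aIfEven i₂ = a

finalTest : Letter → B21
finalTest (X k) = aIfEven (parity k)
finalTest Y = b
finalTest Z = 𝟙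
finalTest (O _) = 𝟙

module _ where
  open ≡-Reasoning

  private
    run : Idx → List Letter → Maybe Idx
    run s w = act s (value finalTest w)

    odd-x-step : ∀ t → act i₁ (aIfEven t) ≡ just t
    odd-x-step i₁ = refl
    odd-x-step i₂ = refl

    odd-sep-step : ∀ t → act t (finalTest (sep (swap t))) ≡ just i₁
    odd-sep-step i₁ = refl
    odd-sep-step i₂ = refl

    even-x-step : ∀ t → act (swap t) (aIfEven t) ≡ just i₂
    even-x-step i₁ = refl
    even-x-step i₂ = refl

    even-sep-step : ∀ t → act i₂ (finalTest (sep t)) ≡ just t
    even-sep-step i₁ = refl
    even-sep-step i₂ = refl

  finalTest-odd-block : ∀ r i v →
    run i₁ (block i r (swap (parity i)) ++ v) ≡ run (parity (i + r)) v
  finalTest-odd-block zero i v = begin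
    run i₁ (X i ∷ v)        ≡⟨ act-value-∷ finalTest (X i) v (odd-x-step (parity i)) ⟩
    run (parity i) v        ≡⟨ cong (λ k → run (parity k) v) (sym (+-identityʳ i)) ⟩
    run (parity (i + 0)) v  ∎
  finalTest-odd-block (suc r) i v = begin
    run i₁ (X i ∷ sep t ∷ rest)
      ≡⟨ act-value-∷ finalTest (X i) (sep t ∷ rest) (odd-x-step (parity i)) ⟩
    run (parity i) (sep t ∷ rest)
      ≡⟨ act-value-∷ finalTest (sep t) rest (odd-sep-step (parity i)) ⟩
    run i₁ (block (suc i) r (swap t) ++ v)
      ≡⟨ cong (λ t → run i₁ (block (suc i) r (swap t) ++ v)) (sym (parity-suc i)) ⟩
    run i₁ (block (suc i) r (swap (parity (suc i))) ++ v)
      ≡⟨ finalTest-odd-block r (suc i) v ⟩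
    run (parity (suc i + r)) v
      ≡⟨ cong (λ k → run (parity k) v) (sym (+-suc i r)) ⟩
    run (parity (i + suc r)) v ∎
    where
      t : Idx
      t = swap (parity i)
      rest : List Letter
      rest = block (suc i) r (swap t) ++ v

  finalTest-even-block : ∀ r i v →
    run (swap (parity i)) (block i r (parity i) ++ v) ≡ run i₂ v
  finalTest-even-block zero i v =
    act-value-∷ finalTest (X i) v (even-x-step (parity i))
  finalTest-even-block (suc r) i v = begin
    run (swap t) (X i ∷ sep t ∷ rest)
      ≡⟨ act-value-∷ finalTest (X i) (sep t ∷ rest) (even-x-step t) ⟩
    run i₂ (sep t ∷ rest)
      ≡⟨ act-value-∷ finalTest (sep t) rest (even-sep-step t) ⟩
    run t rest
      ≡⟨ cong (λ s → run s rest) (sym (swap-involutive t)) ⟩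
    run (swap (swap t)) (block (suc i) r (swap t) ++ v)
      ≡⟨ cong (λ s → run (swap s) (block (suc i) r s ++ v)) (sym (parity-suc i)) ⟩
    run (swap (parity (suc i))) (block (suc i) r (parity (suc i)) ++ v)
      ≡⟨ finalTest-even-block r (suc i) v ⟩
    run i₂ v ∎
    where
      t : Idx
      t = parity i
      rest : List Letter
      rest = block (suc i) r (swap t) ++ v

module Coded (h : ℕ) where

  m : ℕ
  m = suc h + suc h

  next : ℕ → ℕ
  next p with p ≟ m
  ... | yes _ = 0
  ... | no _ = suc p

  next-m : next m ≡ 0
  next-m with m ≟ m
  ... | yes _ = refl
  ... | no m≢m = ⊥-elim (m≢m refl)

  next-suc : ∀ {p} → p ≢ m → next p ≡ suc p
  next-suc {p} p≢m with p ≟ m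
  ... | yes p≡m = ⊥-elim (p≢m p≡m)
  ... | no _ = refl

  next-injective : ∀ {p q} → next p ≡ next q → p ≡ q
  next-injective {p} {q} eq with p ≟ m | q ≟ m
  next-injective eq | yes p≡m | yes q≡m = trans p≡m (sym q≡m)
  next-injective () | yes _ | no _
  next-injective () | no _ | yes _
  next-injective eq | no _ | no _ = suc-injective eq

  next-≢ : ∀ p → next p ≢ p
  next-≢ p with p ≟ m
  ... | yes refl = λ ()
  ... | no _ = λ ()

  lastIs : ℕ → ℕ → Idx
  lastIs p q with p ≟ q
  ... | yes _ = i₂
  ... | no _ = i₁

  lastIs-self : ∀ p → lastIs p p ≡ i₂
  lastIs-self p with p ≟ p
  ... | yes _ = refl
  ... | no p≢p = ⊥-elim (p≢p refl)

  lastIs≡i₂⇒≡ : ∀ {p q} → lastIs p q ≡ i₂ → p ≡ q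
  lastIs≡i₂⇒≡ {p} {q} eq with p ≟ q
  lastIs≡i₂⇒≡ eq | yes p≡q = p≡q
  lastIs≡i₂⇒≡ () | no _

  cyclic : ℕ → Letter → B21
  cyclic q (X j) with j ≟ q | j ≟ next q
  ... | yes _ | _ = a
  ... | no _ | yes _ = b
  ... | no _ | no _ = e i₁ i₁
  cyclic q Y = 𝟙
  cyclic q Z = 𝟙
  cyclic q (O _) = 𝟙

  cyclic-step : ∀ {p j} q → j ≡ next p → j ≢ p →
                act (lastIs p q) (cyclic q (X j)) ≡ just (lastIs j q)
  cyclic-step {p} {j} q j≡np j≢p with p ≟ q | j ≟ q | j ≟ next q
  ... | yes refl | yes refl | _ = ⊥-elim (j≢p refl)
  ... | yes refl | no _ | yes _ = refl
  ... | yes refl | no _ | no j≢nq = ⊥-elim (j≢nq j≡np)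
  ... | no _ | yes _ | _ = refl
  ... | no p≢q | no _ | yes j≡nq = ⊥-elim (p≢q (next-injective (trans (sym j≡np) j≡nq)))
  ... | no _ | no _ | no _ = refl

  cyclic-forced : ∀ {p j r} → act i₂ (cyclic p (X j)) ≡ just r → j ≢ p × j ≡ next p
  cyclic-forced {p} {j} eq with j ≟ p | j ≟ next p
  cyclic-forced () | yes _ | _
  cyclic-forced eq | no j≢p | yes j≡np = j≢p , j≡np
  cyclic-forced () | no _ | no _

  -- v is accepted from the states in which a prefix leaves the three automata:
  -- s for alternating, t for separating, and p the index of the last x read.
  Suffix : Idx → ℕ → Idx → List Letter → Set
  Suffix s p t v = act s (value alternating v) ≡ just i₂
                 × act t (value separating v) ≡ just i₂
                 × (∀ q → act (lastIs p q) (value (cyclic q) v) ≡ just (lastIs m q))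

  suffix-transfer : ∀ {s p t v w} → (∀ f → value f v ≡ value f w) →
                    Suffix s p t w → Suffix s p t v
  suffix-transfer {s} {p} {t} H (α , σ , κ) =
    trans (cong (act s) (H alternating)) α ,
    trans (cong (act t) (H separating)) σ ,
    λ q → trans (cong (act (lastIs p q)) (H (cyclic q))) (κ q)

  suffix-∷ : ∀ {s s′ p p′ t t′} c v →
             act s (alternating c) ≡ just s′ → act t (separating c) ≡ just t′ →
             (∀ q → act (lastIs p q) (cyclic q c) ≡ just (lastIs p′ q)) →
             Suffix s p t (c ∷ v) ⇔ Suffix s′ p′ t′ v
  suffix-∷ {s} {s′} {p} {p′} {t} {t′} c v α σ κ = mk⇔
    (λ (α′ , σ′ , κ′) → trans (sym stepα) α′ , trans (sym stepσ) σ′ ,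
                        λ q → trans (sym (stepκ q)) (κ′ q))
    (λ (α′ , σ′ , κ′) → trans stepα α′ , trans stepσ σ′ , λ q → trans (stepκ q) (κ′ q))
    where
      stepα : act s (value alternating (c ∷ v)) ≡ act s′ (value alternating v)
      stepα = act-value-∷ alternating c v α
      stepσ : act t (value separating (c ∷ v)) ≡ act t′ (value separating v)
      stepσ = act-value-∷ separating c v σ
      stepκ : ∀ q → act (lastIs p q) (value (cyclic q) (c ∷ v)) ≡
                    act (lastIs p′ q) (value (cyclic q) v)
      stepκ q = act-value-∷ (cyclic q) c v (κ q)

  suffix-X : ∀ {p t j} v → j ≡ next p → j ≢ p →
             Suffix i₁ p t (X j ∷ v) ⇔ Suffix i₂ j t v
  suffix-X {j = j} v j≡np j≢p = suffix-∷ (X j) v refl refl (λ q → cyclic-step q j≡np j≢p)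

  suffix-sep : ∀ {p} t v → Suffix i₂ p t (sep t ∷ v) ⇔ Suffix i₁ p (swap t) v
  suffix-sep i₁ v = suffix-∷ Y v refl refl (λ q → refl)
  suffix-sep i₂ v = suffix-∷ Z v refl refl (λ q → refl)

  suffix-X⁻¹ : ∀ {p t} v → Suffix i₁ p t v →
               ∃[ v′ ] v ≡ X (next p) ∷ v′ × Suffix i₂ (next p) t v′
  suffix-X⁻¹ [] (() , _)
  suffix-X⁻¹ {p} (X j ∷ v) S@(_ , _ , κ) with act-value-∷⁻¹ (cyclic p) (X j) v (κ p)
  ... | r , step , _
    with cyclic-forced {p} {j} (subst (λ s → act s (cyclic p (X j)) ≡ just r) (lastIs-self p) step)
  ... | j≢p , refl = v , refl , Equivalence.to (suffix-X v refl j≢p) S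
  suffix-X⁻¹ (Y ∷ v) (α , _) = ⊥-elim (act-value-stuck alternating Y v refl α)
  suffix-X⁻¹ (Z ∷ v) (α , _) = ⊥-elim (act-value-stuck alternating Z v refl α)
  suffix-X⁻¹ (O _ ∷ v) (() , _)

  suffix-sep⁻¹ : ∀ {p t} v → Suffix i₂ p t v →
                 (v ≡ [] × p ≡ m × t ≡ i₂) ⊎ ∃[ v′ ] v ≡ sep t ∷ v′ × Suffix i₁ p (swap t) v′
  suffix-sep⁻¹ {p} [] (_ , refl , κ) =
    inj₁ (refl , sym (lastIs≡i₂⇒≡ (trans (sym (just-injective (κ p))) (lastIs-self p))) , refl)
  suffix-sep⁻¹ (X j ∷ v) (α , _) = ⊥-elim (act-value-stuck alternating (X j) v refl α)
  suffix-sep⁻¹ (O _ ∷ v) (() , _)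
  suffix-sep⁻¹ {t = i₁} (Y ∷ v) S = inj₂ (v , refl , Equivalence.to (suffix-sep i₁ v) S)
  suffix-sep⁻¹ {t = i₂} (Y ∷ v) (_ , σ , _) = ⊥-elim (act-value-stuck separating Y v refl σ)
  suffix-sep⁻¹ {t = i₁} (Z ∷ v) (_ , σ , _) = ⊥-elim (act-value-stuck separating Z v refl σ)
  suffix-sep⁻¹ {t = i₂} (Z ∷ v) S = inj₂ (v , refl , Equivalence.to (suffix-sep i₂ v) S)

  i+1+r≡m⇒i≢m : ∀ {i} r → i + suc r ≡ m → i ≢ m
  i+1+r≡m⇒i≢m {i} r eq i≡m = m+1+n≢m m (subst (λ k → k + suc r ≡ m) i≡m eq)

  i+0≡m⇒i≡m : ∀ {i} → i + 0 ≡ m → i ≡ m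
  i+0≡m⇒i≡m {i} = trans (sym (+-identityʳ i))

  suffix-block⁻¹ : ∀ r {i p t} v → i + r ≡ m → next p ≡ i → Suffix i₁ p t v →
                   ∃[ v′ ] v ≡ block i r t ++ v′ × Suffix i₂ m (swapⁿ r t) v′
  suffix-block⁻¹ zero {t = t} v eq refl S with suffix-X⁻¹ v S
  ... | v′ , refl , S′ = v′ , refl , subst (λ k → Suffix i₂ k t v′) (i+0≡m⇒i≡m eq) S′
  suffix-block⁻¹ (suc r) v eq refl S with suffix-X⁻¹ v S
  ... | v₁ , refl , S₁ with suffix-sep⁻¹ v₁ S₁
  ... | inj₁ (_ , i≡m , _) = ⊥-elim (i+1+r≡m⇒i≢m r eq i≡m)
  ... | inj₂ (v₂ , refl , S₂)
    with suffix-block⁻¹ r v₂ (trans (sym (+-suc _ r)) eq) (next-suc (i+1+r≡m⇒i≢m r eq)) S₂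
  ... | v′ , refl , S′ = v′ , refl , S′

  suffix-block : ∀ r {i p t} v → i + r ≡ m → next p ≡ i → Suffix i₂ m (swapⁿ r t) v →
                 Suffix i₁ p t (block i r t ++ v)
  suffix-block zero {p = p} {t} v eq refl S =
    Equivalence.from (suffix-X v refl (next-≢ p))
      (subst (λ k → Suffix i₂ k t v) (sym (i+0≡m⇒i≡m eq)) S)
  suffix-block (suc r) {p = p} {t} v eq refl S =
    Equivalence.from (suffix-X (sep t ∷ rest) refl (next-≢ p))
      (Equivalence.from (suffix-sep t rest)
        (suffix-block r v (trans (sym (+-suc _ r)) eq) (next-suc (i+1+r≡m⇒i≢m r eq)) S))
    where
      rest : List Letter
      rest = block (suc (next p)) r (swap t) ++ v

  swapⁿ-m : ∀ t → swapⁿ m t ≡ t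
  swapⁿ-m = swapⁿ-double (suc h)

  codedThen : List Letter → List Letter
  codedThen v = block 0 m i₁ ++ Y ∷ block 0 m i₂ ++ v

  coded : List Letter
  coded = codedThen []

  suffix-[] : Suffix i₂ m i₂ []
  suffix-[] = refl , refl , λ _ → refl

  suffix-codedThen : ∀ v → Suffix i₂ m i₂ v → Suffix i₁ m i₁ (codedThen v)
  suffix-codedThen v S =
    suffix-block m middle refl next-m
      (subst (λ t → Suffix i₂ m t middle) (sym (swapⁿ-m i₁))
        (Equivalence.from (suffix-sep i₁ (block 0 m i₂ ++ v))
          (suffix-block m v refl next-m (subst (λ t → Suffix i₂ m t v) (sym (swapⁿ-m i₂)) S))))
    where
      middle : List Letter
      middle = Y ∷ block 0 m i₂ ++ v

  suffix-codedThen⁻¹ : ∀ v → Suffix i₁ m i₁ v →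
                       v ≡ coded ⊎ ∃[ v′ ] v ≡ codedThen (Z ∷ X 0 ∷ v′)
  suffix-codedThen⁻¹ v S with suffix-block⁻¹ m v refl next-m S
  ... | v₁ , refl , S₁ with suffix-sep⁻¹ v₁ (subst (λ t → Suffix i₂ m t v₁) (swapⁿ-m i₁) S₁)
  ... | inj₁ (_ , _ , ())
  ... | inj₂ (v₂ , refl , S₂) with suffix-block⁻¹ m v₂ refl next-m S₂
  ... | v₃ , refl , S₃ with suffix-sep⁻¹ v₃ (subst (λ t → Suffix i₂ m t v₃) (swapⁿ-m i₂) S₃)
  ... | inj₁ (refl , _ , _) = inj₁ refl
  ... | inj₂ (v₄ , refl , S₄) with suffix-X⁻¹ v₄ S₄
  ... | v₅ , refl , _ = inj₂ (v₅ , cong (λ k → codedThen (Z ∷ X k ∷ v₅)) next-m)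

  finalTest-codedThen : ∀ v →
    act i₁ (value finalTest (codedThen v)) ≡ act i₂ (value finalTest v)
  finalTest-codedThen v = begin
    act i₁ (value finalTest (codedThen v))
      ≡⟨ finalTest-odd-block m 0 middle ⟩
    act (parity m) (value finalTest middle)
      ≡⟨ cong (λ t → act t (value finalTest middle)) (swapⁿ-m i₂) ⟩
    act i₂ (value finalTest middle)
      ≡⟨ act-value-∷ finalTest Y (block 0 m i₂ ++ v) refl ⟩
    act i₁ (value finalTest (block 0 m i₂ ++ v))
      ≡⟨ finalTest-even-block m 0 v ⟩
    act i₂ (value finalTest v) ∎
    where
      open ≡-Reasoning
      middle : List Letter
      middle = Y ∷ block 0 m i₂ ++ v

  finalTest-separates : ∀ v →
    value finalTest (codedThen (Z ∷ X 0 ∷ v)) ≢ value finalTest coded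
  finalTest-separates v eq = act-value-stuck finalTest (X 0) v refl (begin
    act i₂ (value finalTest (Z ∷ X 0 ∷ v))
      ≡⟨ sym (finalTest-codedThen (Z ∷ X 0 ∷ v)) ⟩
    act i₁ (value finalTest (codedThen (Z ∷ X 0 ∷ v)))
      ≡⟨ cong (act i₁) eq ⟩
    act i₁ (value finalTest coded)
      ≡⟨ finalTest-codedThen [] ⟩
    just i₂ ∎)
    where open ≡-Reasoning

  coded-isoterm : ∀ v → (∀ f → value f v ≡ value f coded) → v ≡ coded
  coded-isoterm v H
    with suffix-codedThen⁻¹ v (suffix-transfer {v = v} {coded} H (suffix-codedThen [] suffix-[]))
  ... | inj₁ v≡coded = v≡coded
  ... | inj₂ (v′ , refl) = ⊥-elim (finalTest-separates v′ (H finalTest))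

module Classify {m} (x : Fin (suc m) → ℕ) (y z : ℕ) where

  -- x extended to ℕ by a junk value; only x-at (toℕ i) matters.
  x-at : ℕ → ℕ
  x-at k with k <? suc m
  ... | yes k<n = x (fromℕ< k<n)
  ... | no _ = 0

  x-at-toℕ : ∀ i → x-at (toℕ i) ≡ x i
  x-at-toℕ i with toℕ i <? suc m
  ... | yes i<n = cong x (fromℕ<-toℕ i i<n)
  ... | no i≮n = ⊥-elim (i≮n (toℕ<n i))

  classify : ℕ → Letter
  classify c with any? (λ i → x i ≟ c) | c ≟ y | c ≟ z
  ... | yes (i , _) | _ | _ = X (toℕ i)
  ... | no _ | yes _ | _ = Y
  ... | no _ | no _ | yes _ = Z
  ... | no _ | no _ | no _ = O c

  decode : Letter → ℕ
  decode (X k) = x-at k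
  decode Y = y
  decode Z = z
  decode (O c) = c

  decode-classify : ∀ c → decode (classify c) ≡ c
  decode-classify c with any? (λ i → x i ≟ c) | c ≟ y | c ≟ z
  ... | yes (i , xi≡c) | _ | _ = trans (x-at-toℕ i) xi≡c
  ... | no _ | yes c≡y | _ = sym c≡y
  ... | no _ | no _ | yes c≡z = sym c≡z
  ... | no _ | no _ | no _ = refl

  classify-injective : Injective _≡_ _≡_ classify
  classify-injective {c} {d} eq =
    trans (sym (decode-classify c)) (trans (cong decode eq) (decode-classify d))

  module _ (x-injective : Injective _≡_ _≡_ x) (y≢z : y ≢ z)
           (x≢y : ∀ i → x i ≢ y) (x≢z : ∀ i → x i ≢ z) where

    classify-x : ∀ i → classify (x i) ≡ X (toℕ i)
    classify-x i with any? (λ j → x j ≟ x i) | x i ≟ y | x i ≟ z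
    ... | yes (j , xj≡xi) | _ | _ = cong (X ∘ toℕ) (x-injective xj≡xi)
    ... | no ∄j | _ | _ = ⊥-elim (∄j (i , refl))

    classify-sel : ∀ k → classify (sel y z k) ≡ sep (parity k)
    classify-sel zero with any? (λ i → x i ≟ z) | z ≟ y | z ≟ z
    ... | yes (i , xi≡z) | _ | _ = ⊥-elim (x≢z i xi≡z)
    ... | no _ | yes z≡y | _ = ⊥-elim (y≢z (sym z≡y))
    ... | no _ | no _ | yes _ = refl
    ... | no _ | no _ | no z≢z = ⊥-elim (z≢z refl)
    classify-sel (suc zero) with any? (λ i → x i ≟ y) | y ≟ y | y ≟ z
    ... | yes (i , xi≡y) | _ | _ = ⊥-elim (x≢y i xi≡y)
    ... | no _ | yes _ | _ = refl
    ... | no _ | no y≢y | _ = ⊥-elim (y≢y refl)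
    classify-sel (suc (suc k)) = classify-sel k

    classify-weave : ∀ r (g : Fin (suc r) → ℕ) i k →
      (∀ j → classify (g j) ≡ X (i + toℕ j)) →
      map classify (weave (tabulate g) (sel y z) k) ≡ block i r (parity k)
    classify-weave zero g i k g-at = cong (_∷ []) (trans (g-at Fin.zero) (cong X (+-identityʳ i)))
    classify-weave (suc r) g i k g-at =
      cong₂ _∷_ (trans (g-at Fin.zero) (cong X (+-identityʳ i))) (cong₂ _∷_ (classify-sel k) (begin
        map classify (weave (tabulate (g ∘ Fin.suc)) (sel y z) (suc k))
          ≡⟨ classify-weave r (g ∘ Fin.suc) (suc i) (suc k)
               (λ j → trans (g-at (Fin.suc j)) (cong X (+-suc i (toℕ j)))) ⟩
        block (suc i) r (parity (suc k))
          ≡⟨ cong (block (suc i) r) (parity-suc k) ⟩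
        block (suc i) r (swap (parity k)) ∎))
      where open ≡-Reasoning

    classify-wn : map classify (wn (suc m) x y z) ≡
                  block 0 m i₁ ++ sep (parity (suc m)) ∷ block 0 m (parity (suc (suc m)))
    classify-wn = begin
      map classify (weave xs (sel y z) 1 ++ sel y z (suc m) ∷ weave xs (sel y z) (suc (suc m)))
        ≡⟨ map-++ classify (weave xs (sel y z) 1) _ ⟩
      map classify (weave xs (sel y z) 1) ++
        classify (sel y z (suc m)) ∷ map classify (weave xs (sel y z) (suc (suc m)))
        ≡⟨ cong₂ _++_ (weave-x 1) (cong₂ _∷_ (classify-sel (suc m)) (weave-x (suc (suc m)))) ⟩
      block 0 m i₁ ++ sep (parity (suc m)) ∷ block 0 m (parity (suc (suc m))) ∎
      where
        open ≡-Reasoning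
        xs : List ℕ
        xs = map x (allFin (suc m))
        weave-x : ∀ k → map classify (weave xs (sel y z) k) ≡ block 0 m (parity k)
        weave-x k = trans (cong (λ l → map classify (weave l (sel y z) k)) (map-tabulate (λ i → i) x))
                          (classify-weave m x 0 k classify-x)

odd⇒≡1+k+k : ∀ n → n % 2 ≡ 1 → ∃[ k ] n ≡ suc (k + k)
odd⇒≡1+k+k (suc zero) _ = 0 , refl
odd⇒≡1+k+k (suc (suc n)) odd with odd⇒≡1+k+k n odd
... | k , refl = suc k , cong (suc ∘ suc) (sym (+-suc k k))

odd-shape : ∀ {n} → 3 ≤ n → n % 2 ≡ 1 → ∃[ h ] n ≡ suc (suc h + suc h)
odd-shape {n} 3≤n odd with odd⇒≡1+k+k n odd
odd-shape _ _ | suc h , refl = h , refl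
odd-shape (s≤s ()) _ | zero , refl

lemma4p3 : (n : ℕ) → 3 ≤ n → n % 2 ≡ 1 →
    (x : Fin n → ℕ) → (y z : ℕ) →
    Injective _≡_ _≡_ x → ¬ (y ≡ z) →
    (∀ i → ¬ (x i ≡ y)) → (∀ i → ¬ (x i ≡ z)) →
    IsotermB21 (wn n x y z)
lemma4p3 n 3≤n odd x y z x-injective y≢z x≢y x≢z w′ wn≈w′ with odd-shape 3≤n odd
... | h , refl = map-injective classify-injective (begin
  map classify w′             ≡⟨ coded-isoterm (map classify w′) agree ⟩
  coded                       ≡⟨ classify-wn-coded ⟨
  map classify (wn n x y z)   ∎)
  where
    open ≡-Reasoning
    open Coded h
    open Classify x y z

    classify-wn-coded : map classify (wn n x y z) ≡ coded
    classify-wn-coded = trans (classify-wn x-injective y≢z x≢y x≢z)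
      (cong₂ (λ s t → block 0 m i₁ ++ sep s ∷ t) (swapⁿ-m i₁)
        (trans (cong (block 0 m) (swapⁿ-m i₂)) (sym (++-identityʳ _))))

    agree : ∀ f → value f (map classify w′) ≡ value f coded
    agree f = begin
      value f (map classify w′)            ≡⟨ value-map f classify w′ ⟩
      value (f ∘ classify) w′              ≡⟨ wn≈w′ (f ∘ classify) ⟨
      value (f ∘ classify) (wn n x y z)    ≡⟨ value-map f classify (wn n x y z) ⟨
      value f (map classify (wn n x y z))  ≡⟨ cong (value f) classify-wn-coded ⟩
      value f coded                        ∎
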